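{- Let $n_1,n_2$ be positive integers. If, for $i=1,2$, there exists a balancedly splittable Hadamard matrix of order $n_i^2$ with parameters $(n_i^2,n_i,n_i,0)$, then there exists a balancedly splittable Hadamard matrix of order $n_1^2n_2^2$ with parameters $(n_1^2n_2^2,n_1n_2,n_1n_2,0)$.
   Context: A Hadamard matrix of order $n$ is an $n\times n$ $\{1,-1\}$-matrix $H$ with $HH^\top=nI_n$; $J_n$ is the all-ones matrix. $H$ is balancedly splittable with parameters $(n,\ell,a,b)$ if, after permuting its rows, $H=\begin{pmatrix}H_1\\H_2\end{pmatrix}$ with $H_1$ an $\ell\times n$ matrix such that $H_1^\top H_1=\ell I_n+aA+b(J_n-A-I_n)$ for a symmetric $(0,1)$-matrix $A$ with zero diagonal. -}

module Defs where

open import Data.Nat as ℕ using (ℕ; _≤_)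
open import Data.Integer as ℤ using (ℤ; +_; 0ℤ; 1ℤ; -1ℤ)
open import Data.Fin as Fin using (Fin; inject≤)
open import Data.Sum using (_⊎_)
open import Data.Product using (Σ; _×_; ∃-syntax)
open import Relation.Binary.PropositionalEquality using (_≡_)
open import Relation.Nullary using (¬_)
open import Function.Bundles using (_↔_; Inverse)

Matrix : ℕ → ℕ → Set
Matrix m n = Fin m → Fin n → ℤ

sumℤ : (n : ℕ) → (Fin n → ℤ) → ℤ
sumℤ ℕ.zero f = 0ℤ
sumℤ (ℕ.suc n) f = f Fin.zero ℤ.+ sumℤ n (λ k → f (Fin.suc k))

_·_ : ∀ {m k n} → Matrix m k → Matrix k n → Matrix m n
_·_ {k = k} A B i j = sumℤ k (λ t → A i t ℤ.* B t j)

_ᵀ : ∀ {m n} → Matrix m n → Matrix n m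
(A ᵀ) i j = A j i

I : (n : ℕ) → Matrix n n
I n i j with i Fin.≟ j
... | Relation.Nullary.yes _ = 1ℤ
... | Relation.Nullary.no _ = 0ℤ

J : (n : ℕ) → Matrix n n
J n i j = 1ℤ

_•_ : ∀ {m n} → ℤ → Matrix m n → Matrix m n
(c • A) i j = c ℤ.* A i j

_⊕_ : ∀ {m n} → Matrix m n → Matrix m n → Matrix m n
(A ⊕ B) i j = A i j ℤ.+ B i j

_⊖_ : ∀ {m n} → Matrix m n → Matrix m n → Matrix m n
(A ⊖ B) i j = A i j ℤ.- B i j

infixl 7 _·_ _•_
infixl 6 _⊕_ _⊖_

_≋_ : ∀ {m n} → Matrix m n → Matrix m n → Set
A ≋ B = ∀ i j → A i j ≡ B i j
infix 4 _≋_

IsHadamard : (n : ℕ) → Matrix n n → Set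
IsHadamard n H =
  (∀ i j → (H i j ≡ 1ℤ) ⊎ (H i j ≡ -1ℤ)) × (H · (H ᵀ) ≋ (+ n) • I n)

IsAdjacency : (n : ℕ) → Matrix n n → Set
IsAdjacency n A =
  (∀ i j → (A i j ≡ 0ℤ) ⊎ (A i j ≡ 1ℤ)) × (∀ i j → A i j ≡ A j i) × (∀ i → A i i ≡ 0ℤ)

IsBalancedlySplittable : (n ℓ : ℕ) → ℤ → ℤ → Matrix n n → Set
IsBalancedlySplittable n ℓ a b H =
  Σ (ℓ ≤ n) λ ℓ≤n →
  Σ (Fin n ↔ Fin n) λ σ →
  let H₁ : Matrix ℓ n
      H₁ i j = H (Inverse.to σ (inject≤ i ℓ≤n)) j
  in ∃[ A ] (IsAdjacency n A ×
      ((H₁ ᵀ) · H₁ ≋ (+ ℓ) • I n ⊕ a • A ⊕ b • (J n ⊖ A ⊖ I n)))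

BSHExists : (n ℓ : ℕ) → ℤ → ℤ → Set
BSHExists n ℓ a b = ∃[ H ] (IsHadamard n H × IsBalancedlySplittable n ℓ a b H)

-- The witness for order n₁²n₂² is the Kronecker product H = G₁ ⊗ G₂ of the
-- two given matrices.  The whole argument rests on the mixed-product rule
-- (A ⊗ B)(C ⊗ D) = (AC) ⊗ (BD) for rectangular integer matrices:
--   * Hadamard:  H Hᵀ = (G₁G₁ᵀ) ⊗ (G₂G₂ᵀ) = (N₁I) ⊗ (N₂I) = N₁N₂ I.
--   * Splitting: if the top ℓᵢ rows Tᵢ of Gᵢ (after a row permutation σᵢ)
--     satisfy Tᵢᵀ Tᵢ = ℓᵢ (I + Aᵢ), then a suitable permutation of the rows of
--     H (`blockPerm`) puts exactly the rows of T₁ ⊗ T₂ on top, and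
--     (T₁ ⊗ T₂)ᵀ (T₁ ⊗ T₂) = ℓ₁ℓ₂ (I + A₁) ⊗ (I + A₂) = ℓ₁ℓ₂ (I + A)
--     where A is the adjacency matrix of the strong product of the graphs
--     A₁ and A₂.
module Submission where

open import Defs
open import Data.Nat using (ℕ; _*_; NonZero)
open import Data.Integer using (+_)

open import Data.Nat as ℕ using (_≤_; _<_; zero; suc; z≤n; s≤s)
import Data.Nat.Properties as ℕP
open import Data.Integer as ℤ using (ℤ; 0ℤ; 1ℤ; -1ℤ)
import Data.Integer.Properties as ℤP
open import Data.Integer.Tactic.RingSolver using (solve-∀)
open import Data.Fin as Fin
  using (Fin; toℕ; _↑ˡ_; _↑ʳ_; combine; quotient; remainder; inject≤; cast)
import Data.Fin.Properties as FinP
open import Data.Product using (_,_; proj₁; proj₂; _×_)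
open import Data.Product.Function.NonDependent.Propositional using (_×-↔_)
open import Data.Sum as Sum using (_⊎_; inj₁; inj₂)
open import Data.Empty using (⊥-elim)
open import Relation.Nullary using (Dec; yes; no; ¬_)
open import Relation.Binary.PropositionalEquality
  using (_≡_; refl; sym; trans; cong; cong₂; subst; module ≡-Reasoning)
open import Function.Bundles using (_↔_; Inverse; mk↔ₛ′)
open import Function.Properties.Inverse using (↔-trans; ↔-sym)

open ≡-Reasoning

-- Finite sums

sum-cong : ∀ n {f g : Fin n → ℤ} → (∀ k → f k ≡ g k) → sumℤ n f ≡ sumℤ n g
sum-cong zero    f≗g = refl
sum-cong (suc n) f≗g = cong₂ ℤ._+_ (f≗g Fin.zero) (sum-cong n (λ k → f≗g (Fin.suc k)))

sum-split : ∀ a b (f : Fin (a ℕ.+ b) → ℤ) →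
  sumℤ (a ℕ.+ b) f ≡ sumℤ a (λ k → f (k ↑ˡ b)) ℤ.+ sumℤ b (λ k → f (a ↑ʳ k))
sum-split zero    b f = sym (ℤP.+-identityˡ _)
sum-split (suc a) b f =
  trans (cong (λ s → f Fin.zero ℤ.+ s) (sum-split a b (λ k → f (Fin.suc k))))
        (sym (ℤP.+-assoc (f Fin.zero) _ _))

sum-combine : ∀ m n (f : Fin (m * n) → ℤ) →
  sumℤ (m * n) f ≡ sumℤ m (λ i → sumℤ n (λ j → f (combine i j)))
sum-combine zero    n f = refl
sum-combine (suc m) n f =
  trans (sum-split n (m * n) f)
        (cong (λ s → sumℤ n (λ j → f (j ↑ˡ (m * n))) ℤ.+ s)
              (sum-combine m n (λ k → f (n ↑ʳ k))))

sum-*ˡ : ∀ n c (f : Fin n → ℤ) → sumℤ n (λ k → c ℤ.* f k) ≡ c ℤ.* sumℤ n f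
sum-*ˡ zero    c f = sym (ℤP.*-zeroʳ c)
sum-*ˡ (suc n) c f =
  trans (cong (λ s → c ℤ.* f Fin.zero ℤ.+ s) (sum-*ˡ n c (λ k → f (Fin.suc k))))
        (sym (ℤP.*-distribˡ-+ c (f Fin.zero) _))

sum-product : ∀ m n (f : Fin m → ℤ) (g : Fin n → ℤ) →
  sumℤ m (λ i → sumℤ n (λ j → f i ℤ.* g j)) ≡ sumℤ m f ℤ.* sumℤ n g
sum-product m n f g = begin
  sumℤ m (λ i → sumℤ n (λ j → f i ℤ.* g j)) ≡⟨ sum-cong m (λ i → sum-*ˡ n (f i) g) ⟩
  sumℤ m (λ i → f i ℤ.* sumℤ n g)           ≡⟨ sum-cong m (λ i → ℤP.*-comm (f i) _) ⟩
  sumℤ m (λ i → sumℤ n g ℤ.* f i)           ≡⟨ sum-*ˡ m (sumℤ n g) f ⟩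
  sumℤ n g ℤ.* sumℤ m f                     ≡⟨ ℤP.*-comm (sumℤ n g) _ ⟩
  sumℤ m f ℤ.* sumℤ n g                     ∎

·-cong : ∀ {m k n} {A A′ : Matrix m k} {B B′ : Matrix k n} →
  A ≋ A′ → B ≋ B′ → A · B ≋ A′ · B′
·-cong {k = k} A≋A′ B≋B′ i j = sum-cong k (λ t → cong₂ ℤ._*_ (A≋A′ i t) (B≋B′ t j))

I-diag : ∀ {n} {i j : Fin n} → i ≡ j → I n i j ≡ 1ℤ
I-diag {i = i} refl with i Fin.≟ i
... | yes _  = refl
... | no i≢i = ⊥-elim (i≢i refl)

I-off : ∀ {n} {i j : Fin n} → ¬ i ≡ j → I n i j ≡ 0ℤ
I-off {i = i} {j} i≢j with i Fin.≟ j
... | yes i≡j = ⊥-elim (i≢j i≡j)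
... | no _    = refl

I-sym : ∀ n (i j : Fin n) → I n i j ≡ I n j i
I-sym n i j with i Fin.≟ j
... | yes i≡j = sym (I-diag (sym i≡j))
... | no i≢j  = sym (I-off (λ j≡i → i≢j (sym j≡i)))

-- The Kronecker product

-- (A ⊗ B) (i , k) (j , l) = A i j · B k l, where an index of Fin (m₁ * m₂)
-- is read as the pair (quotient, remainder) of Fin m₁ × Fin m₂.
_⊗_ : ∀ {m₁ n₁ m₂ n₂} → Matrix m₁ n₁ → Matrix m₂ n₂ → Matrix (m₁ * m₂) (n₁ * n₂)
_⊗_ {m₁} {n₁} {m₂} {n₂} A B r c =
  A (quotient {m₁} m₂ r) (quotient {n₁} n₂ c) ℤ.* B (remainder {m₁} m₂ r) (remainder {n₁} n₂ c)
infixl 7 _⊗_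

quotient-combine : ∀ {m n} (i : Fin m) (j : Fin n) → quotient {m} n (combine i j) ≡ i
quotient-combine i j = cong proj₁ (FinP.remQuot-combine i j)

remainder-combine : ∀ {m n} (i : Fin m) (j : Fin n) → remainder {m} n (combine i j) ≡ j
remainder-combine i j = cong proj₂ (FinP.remQuot-combine i j)

⊗-row : ∀ {m₁ n₁ m₂ n₂} (A : Matrix m₁ n₁) (B : Matrix m₂ n₂) i k c →
  (A ⊗ B) (combine i k) c ≡ A i (quotient {n₁} n₂ c) ℤ.* B k (remainder {n₁} n₂ c)
⊗-row A B i k c = cong₂ (λ i′ k′ → A i′ _ ℤ.* B k′ _) (quotient-combine i k) (remainder-combine i k)

⊗-col : ∀ {m₁ n₁ m₂ n₂} (A : Matrix m₁ n₁) (B : Matrix m₂ n₂) r j l →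
  (A ⊗ B) r (combine j l) ≡ A (quotient {m₁} m₂ r) j ℤ.* B (remainder {m₁} m₂ r) l
⊗-col A B r j l = cong₂ (λ j′ l′ → A _ j′ ℤ.* B _ l′) (quotient-combine j l) (remainder-combine j l)

⊗-cong : ∀ {m₁ n₁ m₂ n₂} {A A′ : Matrix m₁ n₁} {B B′ : Matrix m₂ n₂} →
  A ≋ A′ → B ≋ B′ → A ⊗ B ≋ A′ ⊗ B′
⊗-cong A≋A′ B≋B′ r c = cong₂ ℤ._*_ (A≋A′ _ _) (B≋B′ _ _)

interchange : ∀ (a b c d : ℤ) → (a ℤ.* b) ℤ.* (c ℤ.* d) ≡ (a ℤ.* c) ℤ.* (b ℤ.* d)
interchange = solve-∀

-- Mixed-product rule; note also that (A ⊗ B)ᵀ = Aᵀ ⊗ Bᵀ holds definitionally.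
⊗-mixed : ∀ {m₁ k₁ n₁ m₂ k₂ n₂}
  (A : Matrix m₁ k₁) (B : Matrix m₂ k₂) (C : Matrix k₁ n₁) (D : Matrix k₂ n₂) →
  (A ⊗ B) · (C ⊗ D) ≋ (A · C) ⊗ (B · D)
⊗-mixed {m₁} {k₁} {n₁} {m₂} {k₂} {n₂} A B C D r c = begin
  sumℤ (k₁ * k₂) (λ t → (A ⊗ B) r t ℤ.* (C ⊗ D) t c)
    ≡⟨ sum-combine k₁ k₂ _ ⟩
  sumℤ k₁ (λ t₁ → sumℤ k₂ (λ t₂ → (A ⊗ B) r (combine t₁ t₂) ℤ.* (C ⊗ D) (combine t₁ t₂) c))
    ≡⟨ sum-cong k₁ (λ t₁ → sum-cong k₂ (λ t₂ → separate t₁ t₂)) ⟩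
  sumℤ k₁ (λ t₁ → sumℤ k₂ (λ t₂ → (A r₁ t₁ ℤ.* C t₁ c₁) ℤ.* (B r₂ t₂ ℤ.* D t₂ c₂)))
    ≡⟨ sum-product k₁ k₂ _ _ ⟩
  (A · C) r₁ c₁ ℤ.* (B · D) r₂ c₂
    ∎
  where
  r₁ : Fin m₁
  r₁ = quotient {m₁} m₂ r
  r₂ : Fin m₂
  r₂ = remainder {m₁} m₂ r
  c₁ : Fin n₁
  c₁ = quotient {n₁} n₂ c
  c₂ : Fin n₂
  c₂ = remainder {n₁} n₂ c
  separate : ∀ t₁ t₂ → (A ⊗ B) r (combine t₁ t₂) ℤ.* (C ⊗ D) (combine t₁ t₂) c
                       ≡ (A r₁ t₁ ℤ.* C t₁ c₁) ℤ.* (B r₂ t₂ ℤ.* D t₂ c₂)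
  separate t₁ t₂ = trans (cong₂ ℤ._*_ (⊗-col A B r t₁ t₂) (⊗-row C D t₁ t₂ c))
                         (interchange (A r₁ t₁) (B r₂ t₂) (C t₁ c₁) (D t₂ c₂))

⊗-scalar : ∀ {m₁ n₁ m₂ n₂} a b (A : Matrix m₁ n₁) (B : Matrix m₂ n₂) →
  (a • A) ⊗ (b • B) ≋ (a ℤ.* b) • (A ⊗ B)
⊗-scalar a b A B r c = interchange a _ b _

-- I ⊗ I = I: two pairs of indices are equal iff both components are.
⊗-identity : ∀ m n → I m ⊗ I n ≋ I (m * n)
⊗-identity m n c d = byCases (c₁ Fin.≟ d₁) (c₂ Fin.≟ d₂)
  where
  c₁ d₁ : Fin m
  c₁ = quotient {m} n c
  d₁ = quotient {m} n d
  c₂ d₂ : Fin n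
  c₂ = remainder {m} n c
  d₂ = remainder {m} n d
  byCases : Dec (c₁ ≡ d₁) → Dec (c₂ ≡ d₂) → I m c₁ d₁ ℤ.* I n c₂ d₂ ≡ I (m * n) c d
  byCases (yes c₁≡d₁) (yes c₂≡d₂) = begin
    I m c₁ d₁ ℤ.* I n c₂ d₂ ≡⟨ cong₂ ℤ._*_ (I-diag c₁≡d₁) (I-diag c₂≡d₂) ⟩
    1ℤ                      ≡⟨ sym (I-diag c≡d) ⟩
    I (m * n) c d           ∎
    where
    c≡d : c ≡ d
    c≡d = trans (sym (FinP.combine-remQuot {m} n c))
                (trans (cong₂ combine c₁≡d₁ c₂≡d₂) (FinP.combine-remQuot {m} n d))
  byCases (no c₁≢d₁) _ = trans (cong (ℤ._* I n c₂ d₂) (I-off c₁≢d₁))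
                               (sym (I-off (λ c≡d → c₁≢d₁ (cong (quotient {m} n) c≡d))))
  byCases (yes _) (no c₂≢d₂) = trans (cong (I m c₁ d₁ ℤ.*_) (I-off c₂≢d₂))
                               (trans (ℤP.*-zeroʳ (I m c₁ d₁))
                                      (sym (I-off (λ c≡d → c₂≢d₂ (cong (remainder {m} n) c≡d)))))

±1-* : ∀ {a b : ℤ} → (a ≡ 1ℤ) ⊎ (a ≡ -1ℤ) → (b ≡ 1ℤ) ⊎ (b ≡ -1ℤ) →
  (a ℤ.* b ≡ 1ℤ) ⊎ (a ℤ.* b ≡ -1ℤ)
±1-* (inj₁ refl) (inj₁ refl) = inj₁ refl
±1-* (inj₁ refl) (inj₂ refl) = inj₂ refl
±1-* (inj₂ refl) (inj₁ refl) = inj₂ refl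
±1-* (inj₂ refl) (inj₂ refl) = inj₁ refl

isHadamard-⊗ : ∀ {m n} {A : Matrix m m} {B : Matrix n n} →
  IsHadamard m A → IsHadamard n B → IsHadamard (m * n) (A ⊗ B)
isHadamard-⊗ {m} {n} {A} {B} (A±1 , AAᵀ) (B±1 , BBᵀ) =
  (λ r c → ±1-* (A±1 _ _) (B±1 _ _)) , orthogonal
  where
  orthogonal : (A ⊗ B) · (A ⊗ B) ᵀ ≋ (+ (m * n)) • I (m * n)
  orthogonal r c = begin
    ((A ⊗ B) · (A ᵀ ⊗ B ᵀ)) r c                  ≡⟨ ⊗-mixed A B (A ᵀ) (B ᵀ) r c ⟩
    ((A · A ᵀ) ⊗ (B · B ᵀ)) r c                  ≡⟨ ⊗-cong AAᵀ BBᵀ r c ⟩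
    (((+ m) • I m) ⊗ ((+ n) • I n)) r c          ≡⟨ ⊗-scalar (+ m) (+ n) (I m) (I n) r c ⟩
    ((+ m ℤ.* + n) • (I m ⊗ I n)) r c            ≡⟨ cong₂ ℤ._*_ (sym (ℤP.pos-* m n)) (⊗-identity m n r c) ⟩
    ((+ (m * n)) • I (m * n)) r c                ∎

-- Strong products of graphs

-- The adjacency matrix of the strong product of the graphs A and B: distinct
-- pairs are adjacent iff each coordinate is equal or adjacent.
strongProduct : ∀ {m n} → Matrix m m → Matrix n n → Matrix (m * n) (m * n)
strongProduct {m} {n} A B = (I m ⊕ A) ⊗ (I n ⊕ B) ⊖ I (m * n)

closure-strongProduct : ∀ {m n} (A : Matrix m m) (B : Matrix n n) →
  I (m * n) ⊕ strongProduct A B ≋ (I m ⊕ A) ⊗ (I n ⊕ B)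
closure-strongProduct {m} {n} A B r c = cancel (I (m * n) r c) (((I m ⊕ A) ⊗ (I n ⊕ B)) r c)
  where
  cancel : ∀ (i p : ℤ) → i ℤ.+ (p ℤ.- i) ≡ p
  cancel = solve-∀

closure-01 : ∀ {n} {A : Matrix n n} → IsAdjacency n A →
  ∀ i j → ((I n ⊕ A) i j ≡ 0ℤ) ⊎ ((I n ⊕ A) i j ≡ 1ℤ)
closure-01 {n} {A} (A01 , _ , A-diag) i j = byCases (i Fin.≟ j)
  where
  byCases : Dec (i ≡ j) → ((I n ⊕ A) i j ≡ 0ℤ) ⊎ ((I n ⊕ A) i j ≡ 1ℤ)
  byCases (yes refl) = inj₂ (cong₂ ℤ._+_ (I-diag {i = i} refl) (A-diag i))
  byCases (no i≢j)   = Sum.map (cong₂ ℤ._+_ (I-off i≢j)) (cong₂ ℤ._+_ (I-off i≢j)) (A01 i j)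

01-* : ∀ {a b : ℤ} → (a ≡ 0ℤ) ⊎ (a ≡ 1ℤ) → (b ≡ 0ℤ) ⊎ (b ≡ 1ℤ) →
  (a ℤ.* b ≡ 0ℤ) ⊎ (a ℤ.* b ≡ 1ℤ)
01-* (inj₁ refl) _           = inj₁ refl
01-* (inj₂ refl) (inj₁ refl) = inj₁ refl
01-* (inj₂ refl) (inj₂ refl) = inj₂ refl

isAdjacency-strongProduct : ∀ {m n} {A : Matrix m m} {B : Matrix n n} →
  IsAdjacency m A → IsAdjacency n B → IsAdjacency (m * n) (strongProduct A B)
isAdjacency-strongProduct {m} {n} {A} {B} adjA@(_ , A-sym , A-diag) adjB@(_ , B-sym , B-diag) =
  zero-one , symmetric , diagonal
  where
  diagonal : ∀ c → strongProduct A B c c ≡ 0ℤ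
  diagonal c = cong₂ ℤ._-_
    (cong₂ ℤ._*_ (cong₂ ℤ._+_ (I-diag {i = quotient {m} n c} refl) (A-diag _))
                 (cong₂ ℤ._+_ (I-diag {i = remainder {m} n c} refl) (B-diag _)))
    (I-diag {i = c} refl)

  symmetric : ∀ c d → strongProduct A B c d ≡ strongProduct A B d c
  symmetric c d = cong₂ ℤ._-_
    (cong₂ ℤ._*_ (cong₂ ℤ._+_ (I-sym m c₁ d₁) (A-sym c₁ d₁))
                 (cong₂ ℤ._+_ (I-sym n c₂ d₂) (B-sym c₂ d₂)))
    (I-sym (m * n) c d)
    where
    c₁ d₁ : Fin m
    c₁ = quotient {m} n c
    d₁ = quotient {m} n d
    c₂ d₂ : Fin n
    c₂ = remainder {m} n c
    d₂ = remainder {m} n d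

  zero-one : ∀ c d → (strongProduct A B c d ≡ 0ℤ) ⊎ (strongProduct A B c d ≡ 1ℤ)
  zero-one c d = byCases (c Fin.≟ d)
    where
    byCases : Dec (c ≡ d) → (strongProduct A B c d ≡ 0ℤ) ⊎ (strongProduct A B c d ≡ 1ℤ)
    byCases (yes refl) = inj₁ (diagonal c)
    byCases (no c≢d)   = Sum.map (λ P≡0 → cong₂ ℤ._-_ P≡0 (I-off c≢d))
                                 (λ P≡1 → cong₂ ℤ._-_ P≡1 (I-off c≢d))
                                 (01-* (closure-01 adjA (quotient {m} n c) (quotient {m} n d))
                                       (closure-01 adjB (remainder {m} n c) (remainder {m} n d)))

topRows : ∀ {n ℓ k} → Fin n ↔ Fin n → ℓ ≤ n → Matrix n k → Matrix ℓ k
topRows σ ℓ≤n H i j = H (Inverse.to σ (inject≤ i ℓ≤n)) j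

split-ℓℓ0 : ∀ {n} ℓ (A : Matrix n n) →
  (+ ℓ) • I n ⊕ (+ ℓ) • A ⊕ (+ 0) • (J n ⊖ A ⊖ I n) ≋ (+ ℓ) • (I n ⊕ A)
split-ℓℓ0 ℓ A i j = collect (+ ℓ) _ _
  where
  collect : ∀ (l x a : ℤ) → l ℤ.* x ℤ.+ l ℤ.* a ℤ.+ + 0 ℤ.* (1ℤ ℤ.- a ℤ.- x) ≡ l ℤ.* (x ℤ.+ a)
  collect = solve-∀

-- The block permutation

firstBlock : ∀ {m n} (x : Fin (m * n)) → toℕ x < n →
  toℕ (quotient {m} n x) ≡ 0 × toℕ (remainder {m} n x) ≡ toℕ x
firstBlock {m} {n} x x<n = inFirstBlock _ _ decomposition x<n
  where
  decomposition : toℕ x ≡ n * toℕ (quotient {m} n x) ℕ.+ toℕ (remainder {m} n x)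
  decomposition = trans (cong toℕ (sym (FinP.combine-remQuot {m} n x)))
                        (FinP.toℕ-combine (quotient {m} n x) (remainder {m} n x))
  inFirstBlock : ∀ {y} q r → y ≡ n * q ℕ.+ r → y < n → q ≡ 0 × r ≡ y
  inFirstBlock zero    r refl _ = refl , cong (ℕ._+ r) (sym (ℕP.*-zeroʳ n))
  inFirstBlock (suc q) r refl y<n =
    ⊥-elim (ℕP.<⇒≱ y<n (ℕP.≤-trans (ℕP.m≤m*n n (suc q)) (ℕP.m≤m+n _ r)))

firstIndex : ∀ {m n} (x : Fin (m * n)) → toℕ x ≡ 0 →
  toℕ (quotient {m} n x) ≡ 0 × toℕ (remainder {m} n x) ≡ 0
firstIndex {m} {n} x x≡0 = proj₁ small , trans (proj₂ small) x≡0
  where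
  0<n : 0 < n
  0<n = ℕP.≤-trans (s≤s z≤n) (FinP.toℕ<n (remainder {m} n x))
  small : toℕ (quotient {m} n x) ≡ 0 × toℕ (remainder {m} n x) ≡ toℕ x
  small = firstBlock x (subst (_< n) (sym x≡0) 0<n)

combine-first : ∀ {m n} (z : Fin m) (i : Fin n) (n≤mn : n ≤ m * n) →
  toℕ z ≡ 0 → combine z i ≡ inject≤ i n≤mn
combine-first {n = n} z i n≤mn z≡0 = FinP.toℕ-injective (begin
  toℕ (combine z i)       ≡⟨ FinP.toℕ-combine z i ⟩
  n * toℕ z ℕ.+ toℕ i     ≡⟨ cong (λ k → n * k ℕ.+ toℕ i) z≡0 ⟩
  n * 0 ℕ.+ toℕ i         ≡⟨ cong (ℕ._+ toℕ i) (ℕP.*-zeroʳ n) ⟩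
  toℕ i                   ≡⟨ FinP.toℕ-inject≤ i n≤mn ⟨
  toℕ (inject≤ i n≤mn)    ∎)

cast↔ : ∀ {m n} → m ≡ n → Fin m ↔ Fin n
cast↔ e = mk↔ₛ′ (cast e) (cast (sym e)) (FinP.cast-involutive e (sym e)) (FinP.cast-involutive (sym e) e)

interchange↔ : ∀ {A B C D : Set} → ((A × B) × (C × D)) ↔ ((A × C) × (B × D))
interchange↔ = mk↔ₛ′ swapMiddle swapMiddle (λ _ → refl) (λ _ → refl)
  where
  swapMiddle : ∀ {A B C D : Set} → (A × B) × (C × D) → (A × C) × (B × D)
  swapMiddle ((a , b) , (c , d)) = (a , c) , (b , d)

-- Fin ((m₁ℓ₁)(m₂ℓ₂)) ≅ Fin (m₁m₂) × Fin (ℓ₁ℓ₂) ≅ (Fin m₁ × Fin ℓ₁) × (Fin m₂ × Fin ℓ₂)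
-- ≅ Fin (m₁ℓ₁) × Fin (m₂ℓ₂): the first ℓ₁ℓ₂ indices go to the pairs of
-- first-block indices.
blockCoords : ∀ m₁ ℓ₁ m₂ ℓ₂ → Fin ((m₁ * ℓ₁) * (m₂ * ℓ₂)) ↔ (Fin (m₁ * ℓ₁) × Fin (m₂ * ℓ₂))
blockCoords m₁ ℓ₁ m₂ ℓ₂ =
  ↔-trans (cast↔ (ℕP.[m*n]*[o*p]≡[m*o]*[n*p] m₁ ℓ₁ m₂ ℓ₂))
  (↔-trans (FinP.*↔× {m₁ * m₂} {ℓ₁ * ℓ₂})
  (↔-trans (FinP.*↔× {m₁} {m₂} ×-↔ FinP.*↔× {ℓ₁} {ℓ₂})
  (↔-trans interchange↔
           (↔-sym (FinP.*↔× {m₁} {ℓ₁}) ×-↔ ↔-sym (FinP.*↔× {m₂} {ℓ₂})))))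

blockCoords-top : ∀ {m₁ ℓ₁ m₂ ℓ₂} (ℓ₁≤ : ℓ₁ ≤ m₁ * ℓ₁) (ℓ₂≤ : ℓ₂ ≤ m₂ * ℓ₂)
  (ℓ≤ : ℓ₁ * ℓ₂ ≤ (m₁ * ℓ₁) * (m₂ * ℓ₂)) (t : Fin (ℓ₁ * ℓ₂)) →
  Inverse.to (blockCoords m₁ ℓ₁ m₂ ℓ₂) (inject≤ t ℓ≤)
    ≡ (inject≤ (quotient {ℓ₁} ℓ₂ t) ℓ₁≤ , inject≤ (remainder {ℓ₁} ℓ₂ t) ℓ₂≤)
blockCoords-top {m₁} {ℓ₁} {m₂} {ℓ₂} ℓ₁≤ ℓ₂≤ ℓ≤ t =
  cong₂ _,_
    (trans (cong (λ s → combine q₁ (quotient {ℓ₁} ℓ₂ s)) y₂≡t)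
           (combine-first q₁ _ ℓ₁≤ (proj₁ q-zero)))
    (trans (cong (λ s → combine q₂ (remainder {ℓ₁} ℓ₂ s)) y₂≡t)
           (combine-first q₂ _ ℓ₂≤ (proj₂ q-zero)))
  where
  y : Fin ((m₁ * m₂) * (ℓ₁ * ℓ₂))
  y = cast (ℕP.[m*n]*[o*p]≡[m*o]*[n*p] m₁ ℓ₁ m₂ ℓ₂) (inject≤ t ℓ≤)
  toℕ-y : toℕ y ≡ toℕ t
  toℕ-y = trans (FinP.toℕ-cast _ (inject≤ t ℓ≤)) (FinP.toℕ-inject≤ t ℓ≤)
  y-first : toℕ (quotient {m₁ * m₂} (ℓ₁ * ℓ₂) y) ≡ 0 × toℕ (remainder {m₁ * m₂} (ℓ₁ * ℓ₂) y) ≡ toℕ y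
  y-first = firstBlock {m₁ * m₂} y (subst (_< ℓ₁ * ℓ₂) (sym toℕ-y) (FinP.toℕ<n t))
  y₂≡t : remainder {m₁ * m₂} (ℓ₁ * ℓ₂) y ≡ t
  y₂≡t = FinP.toℕ-injective (trans (proj₂ y-first) toℕ-y)
  q : Fin (m₁ * m₂)
  q = quotient {m₁ * m₂} (ℓ₁ * ℓ₂) y
  q₁ : Fin m₁
  q₁ = quotient {m₁} m₂ q
  q₂ : Fin m₂
  q₂ = remainder {m₁} m₂ q
  q-zero : toℕ q₁ ≡ 0 × toℕ q₂ ≡ 0
  q-zero = firstIndex q (proj₁ y-first)

-- Permutation of the rows of G₁ ⊗ G₂ whose top ℓ₁ℓ₂ rows are those of T₁ ⊗ T₂.
blockPerm : ∀ {m₁ ℓ₁ m₂ ℓ₂} → Fin (m₁ * ℓ₁) ↔ Fin (m₁ * ℓ₁) → Fin (m₂ * ℓ₂) ↔ Fin (m₂ * ℓ₂) →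
  Fin ((m₁ * ℓ₁) * (m₂ * ℓ₂)) ↔ Fin ((m₁ * ℓ₁) * (m₂ * ℓ₂))
blockPerm {m₁} {ℓ₁} {m₂} {ℓ₂} σ₁ σ₂ =
  ↔-trans (blockCoords m₁ ℓ₁ m₂ ℓ₂) (↔-trans (σ₁ ×-↔ σ₂) (↔-sym FinP.*↔×))

topRows-⊗ : ∀ {m₁ ℓ₁ m₂ ℓ₂ n₁ n₂} (σ₁ : Fin (m₁ * ℓ₁) ↔ Fin (m₁ * ℓ₁))
  (σ₂ : Fin (m₂ * ℓ₂) ↔ Fin (m₂ * ℓ₂)) (ℓ₁≤ : ℓ₁ ≤ m₁ * ℓ₁) (ℓ₂≤ : ℓ₂ ≤ m₂ * ℓ₂)
  (ℓ≤ : ℓ₁ * ℓ₂ ≤ (m₁ * ℓ₁) * (m₂ * ℓ₂)) (G₁ : Matrix (m₁ * ℓ₁) n₁) (G₂ : Matrix (m₂ * ℓ₂) n₂) →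
  topRows (blockPerm {m₁} {ℓ₁} {m₂} {ℓ₂} σ₁ σ₂) ℓ≤ (G₁ ⊗ G₂) ≋ topRows σ₁ ℓ₁≤ G₁ ⊗ topRows σ₂ ℓ₂≤ G₂
topRows-⊗ {m₁} {ℓ₁} {m₂} {ℓ₂} σ₁ σ₂ ℓ₁≤ ℓ₂≤ ℓ≤ G₁ G₂ t c =
  trans (cong (λ p → (G₁ ⊗ G₂) (combine (Inverse.to σ₁ (proj₁ p)) (Inverse.to σ₂ (proj₂ p))) c)
              (blockCoords-top {m₁} {ℓ₁} {m₂} {ℓ₂} ℓ₁≤ ℓ₂≤ ℓ≤ t))
        (⊗-row G₁ G₂ _ _ c)

isBalancedlySplittable-⊗ : ∀ {m₁ ℓ₁ m₂ ℓ₂}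
  {G₁ : Matrix (m₁ * ℓ₁) (m₁ * ℓ₁)} {G₂ : Matrix (m₂ * ℓ₂) (m₂ * ℓ₂)} →
  IsBalancedlySplittable (m₁ * ℓ₁) ℓ₁ (+ ℓ₁) (+ 0) G₁ →
  IsBalancedlySplittable (m₂ * ℓ₂) ℓ₂ (+ ℓ₂) (+ 0) G₂ →
  IsBalancedlySplittable ((m₁ * ℓ₁) * (m₂ * ℓ₂)) (ℓ₁ * ℓ₂) (+ (ℓ₁ * ℓ₂)) (+ 0) (G₁ ⊗ G₂)
isBalancedlySplittable-⊗ {m₁} {ℓ₁} {m₂} {ℓ₂} {G₁} {G₂}
  (ℓ₁≤ , σ₁ , A₁ , adj₁ , gram₁) (ℓ₂≤ , σ₂ , A₂ , adj₂ , gram₂) =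
  ℓ≤ , blockPerm {m₁} {ℓ₁} {m₂} {ℓ₂} σ₁ σ₂ , strongProduct A₁ A₂ , isAdjacency-strongProduct adj₁ adj₂ , gram
  where
  N : ℕ
  N = (m₁ * ℓ₁) * (m₂ * ℓ₂)
  ℓ≤ : ℓ₁ * ℓ₂ ≤ N
  ℓ≤ = ℕP.*-mono-≤ ℓ₁≤ ℓ₂≤
  H₁ : Matrix (ℓ₁ * ℓ₂) N
  H₁ = topRows (blockPerm {m₁} {ℓ₁} {m₂} {ℓ₂} σ₁ σ₂) ℓ≤ (G₁ ⊗ G₂)
  T₁ : Matrix ℓ₁ (m₁ * ℓ₁)
  T₁ = topRows σ₁ ℓ₁≤ G₁
  T₂ : Matrix ℓ₂ (m₂ * ℓ₂)
  T₂ = topRows σ₂ ℓ₂≤ G₂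
  A : Matrix N N
  A = strongProduct A₁ A₂
  top : H₁ ≋ T₁ ⊗ T₂
  top = topRows-⊗ {m₁} {ℓ₁} {m₂} {ℓ₂} σ₁ σ₂ ℓ₁≤ ℓ₂≤ ℓ≤ G₁ G₂
  gram : H₁ ᵀ · H₁ ≋ (+ (ℓ₁ * ℓ₂)) • I N ⊕ (+ (ℓ₁ * ℓ₂)) • A ⊕ (+ 0) • (J N ⊖ A ⊖ I N)
  gram c d = begin
    (H₁ ᵀ · H₁) c d
      ≡⟨ ·-cong (λ i j → top j i) top c d ⟩
    ((T₁ ᵀ ⊗ T₂ ᵀ) · (T₁ ⊗ T₂)) c d
      ≡⟨ ⊗-mixed (T₁ ᵀ) (T₂ ᵀ) T₁ T₂ c d ⟩
    ((T₁ ᵀ · T₁) ⊗ (T₂ ᵀ · T₂)) c d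
      ≡⟨ ⊗-cong (λ i j → trans (gram₁ i j) (split-ℓℓ0 ℓ₁ A₁ i j))
                (λ i j → trans (gram₂ i j) (split-ℓℓ0 ℓ₂ A₂ i j)) c d ⟩
    (((+ ℓ₁) • (I (m₁ * ℓ₁) ⊕ A₁)) ⊗ ((+ ℓ₂) • (I (m₂ * ℓ₂) ⊕ A₂))) c d
      ≡⟨ ⊗-scalar (+ ℓ₁) (+ ℓ₂) (I (m₁ * ℓ₁) ⊕ A₁) (I (m₂ * ℓ₂) ⊕ A₂) c d ⟩
    ((+ ℓ₁ ℤ.* + ℓ₂) • ((I (m₁ * ℓ₁) ⊕ A₁) ⊗ (I (m₂ * ℓ₂) ⊕ A₂))) c d
      ≡⟨ cong₂ ℤ._*_ (sym (ℤP.pos-* ℓ₁ ℓ₂)) (sym (closure-strongProduct A₁ A₂ c d)) ⟩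
    ((+ (ℓ₁ * ℓ₂)) • (I N ⊕ A)) c d
      ≡⟨ split-ℓℓ0 (ℓ₁ * ℓ₂) A c d ⟨
    ((+ (ℓ₁ * ℓ₂)) • I N ⊕ (+ (ℓ₁ * ℓ₂)) • A ⊕ (+ 0) • (J N ⊖ A ⊖ I N)) c d
      ∎

lemma3p5 : (n₁ n₂ : ℕ) → NonZero n₁ → NonZero n₂ →
    BSHExists (n₁ * n₁) n₁ (+ n₁) (+ 0) →
    BSHExists (n₂ * n₂) n₂ (+ n₂) (+ 0) →
    BSHExists ((n₁ * n₁) * (n₂ * n₂)) (n₁ * n₂) (+ (n₁ * n₂)) (+ 0)
lemma3p5 n₁ n₂ _ _ (G₁ , hadamard₁ , split₁) (G₂ , hadamard₂ , split₂) =
  G₁ ⊗ G₂ , isHadamard-⊗ hadamard₁ hadamard₂ ,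
  isBalancedlySplittable-⊗ {n₁} {n₁} {n₂} {n₂} {G₁} {G₂} split₁ split₂
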